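{- Let $B\in\mathcal{PM}(n)$, $C\in\mathcal{PM}(m)$ and $i\in[n]$. Then: (1) if $A=B\,\square_i\,C$, then $A^*=B^*\,\square_{n-i+1}\,C^*$; (2) if $A=B\circ^{\min}_i C$, then $A^*=B^*\circ^{\max}_{n-i+1}C^*$.
   Context: A poset matrix of order $n$ is an $n\times n$ $(0,1)$-matrix $A=[a_{st}]$ that is lower triangular with all diagonal entries $1$ and transitive ($a_{st}=a_{tu}=1\Rightarrow a_{su}=1$); $\mathcal{PM}(n)$ is the set of these. For $A$ of order $N$, its dual is $A^*=EA^TE$, where $E$ is the $N\times N$ backward identity matrix (ones on the antidiagonal, zeros elsewhere). The poset associated to $B=[b_{st}]\in\mathcal{PM}(m)$ is $[m]$ with $t\le s$ iff $b_{st}=1$. $A[\alpha\mid\beta]$ is the submatrix with rows $\alpha$ and columns $\beta$, $A[\alpha]=A[\alpha\mid\alpha]$. For $A\in\mathcal{PM}(n)$ and $i\in[n]$: $A_{11}=A[\{1..i-1\}]$, $A_{22}=A[\{i+1..n\}]$, $A_{21}=A[\{i+1..n\}\mid\{1..i-1\}]$, $A_{(i)}=A[\{i\}\mid\{1..i-1\}]$, $A^{(i)}=A[\{i+1..n\}\mid\{i\}]$; empty blocks are vacuous. For $B\in\mathcal{PM}(m)$: $A\,\square_i\,B=\begin{pmatrix}A_{11}&\mathbb{O}&\mathbb{O}\\ \mathbb{1}_m^T\otimes A_{(i)}&B&\mathbb{O}\\ A_{21}&\mathbb{1}_m\otimes A^{(i)}&A_{22}\end{pmatrix}$, $A\circ^{\min}_i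 B=\begin{pmatrix}A_{11}&\mathbb{O}&\mathbb{O}\\ \mathbb{1}_m^T\otimes A_{(i)}&B&\mathbb{O}\\ A_{21}&\mathrm{Min}_i(A,B)&A_{22}\end{pmatrix}$, $A\circ^{\max}_i B=\begin{pmatrix}A_{11}&\mathbb{O}&\mathbb{O}\\ \mathrm{Max}_i(A,B)&B&\mathbb{O}\\ A_{21}&\mathbb{1}_m\otimes A^{(i)}&A_{22}\end{pmatrix}$, where $\mathbb{1}_m^T\otimes A_{(i)}$ is the $m\times(i-1)$ matrix with all rows $A_{(i)}$, $\mathbb{1}_m\otimes A^{(i)}$ the $(n-i)\times m$ matrix with all columns $A^{(i)}$, $\mathrm{Min}_i(A,B)$ the $(n-i)\times m$ matrix whose $j$-th column is $A^{(i)}$ if $j$ is minimal in the poset of $B$ and zero otherwise, and $\mathrm{Max}_i(A,B)$ the $m\times(i-1)$ matrix whose $j$-th row is $A_{(i)}$ if $j$ is maximal in the poset of $B$ and zero otherwise. -}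

module Defs where

open import Data.Nat using (ℕ; zero; suc; _+_; _∸_; _<_; _<ᵇ_; _<?_)
open import Data.Fin using (Fin; toℕ; fromℕ<; opposite; _≟_)
open import Data.Bool using (Bool; true; false; not; _∨_; if_then_else_)
open import Data.List using (allFin)
open import Data.Bool.ListAction using (all)
open import Relation.Nullary using (yes; no; ⌊_⌋)
open import Relation.Binary.PropositionalEquality using (_≡_)

-- Square (0,1)-matrices of order n, entries indexed 0-based by Fin n.
Mat : ℕ → Set
Mat n = Fin n → Fin n → Bool

record IsPosetMatrix {n : ℕ} (A : Mat n) : Set where
  field
    lowerTri : ∀ s t → toℕ s < toℕ t → A s t ≡ false
    diag     : ∀ s → A s s ≡ true
    trans    : ∀ s t u → A s t ≡ true → A t u ≡ true → A s u ≡ true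

-- Dual A* = E Aᵀ E : (A*)_{st} = A_{(n-1-t),(n-1-s)} (0-based).
dual : {n : ℕ} → Mat n → Mat n
dual A s t = A (opposite t) (opposite s)

_≡ᴹ_ : {n : ℕ} → Mat n → Mat n → Set
A ≡ᴹ A' = ∀ s t → A s t ≡ A' s t

-- Read an entry at natural-number indices (false outside the range;
-- only ever used in range).
at : {n : ℕ} → Mat n → ℕ → ℕ → Bool
at {n} A r c with r <? n | c <? n
... | yes p | yes q = A (fromℕ< p) (fromℕ< q)
... | _     | _     = false

-- j is minimal in the poset of C (t ≤ s iff C s t = 1): no t ≠ j with t ≤ j.
minimalᵇ : {m : ℕ} → Mat m → Fin m → Bool
minimalᵇ {m} C j = all (λ t → ⌊ t ≟ j ⌋ ∨ not (C j t)) (allFin m)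

maximalᵇ : {m : ℕ} → Mat m → Fin m → Bool
maximalᵇ {m} C j = all (λ s → ⌊ s ≟ j ⌋ ∨ not (C s j)) (allFin m)

data Region : Set where
  R1 R2 R3 : Region

region : ℕ → ℕ → ℕ → Region
region k m r = if r <ᵇ k then R1 else (if r <ᵇ k + m then R2 else R3)

-- Generic block matrix of order (n ∸ 1) + m obtained by replacing the
-- i-th row/column of B (paper index i = toℕ i + 1) by the block C.
-- Arguments L (row block (2,1)) and D (block (3,2)) are given as functions
-- of (row of C, column of B) and (row of B, column of C) respectively.
blockMat : {n m : ℕ} (B : Mat n) (i : Fin n) (C : Mat m)
  → (ℕ → ℕ → Bool)
  → (ℕ → ℕ → Bool)
  → Mat ((n ∸ 1) + m)
blockMat {n} {m} B i C L D s t = go (region k m r) (region k m c)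
  where
  k = toℕ i
  r = toℕ s
  c = toℕ t
  -- original index in B for rows/columns in region 3
  r3 = r + 1 ∸ m
  c3 = c + 1 ∸ m
  go : Region → Region → Bool
  go R1 R1 = at B r c
  go R2 R1 = L (r ∸ k) c
  go R2 R2 = at C (r ∸ k) (c ∸ k)
  go R3 R1 = at B r3 c
  go R3 R2 = D r3 (c ∸ k)
  go R3 R3 = at B r3 c3
  go _  _  = false

box : {n m : ℕ} → Mat n → Fin n → Mat m → Mat ((n ∸ 1) + m)
box B i C = blockMat B i C (λ _ c → at B (toℕ i) c) (λ r _ → at B r (toℕ i))

-- Min_i(B,C) column j is B^{(i)} if j minimal in poset of C, else 0.
minBlock : {m : ℕ} → Mat m → ℕ → Bool
minBlock {m} C j with j <? m
... | yes p = minimalᵇ C (fromℕ< p)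
... | no _  = false

maxBlock : {m : ℕ} → Mat m → ℕ → Bool
maxBlock {m} C j with j <? m
... | yes p = maximalᵇ C (fromℕ< p)
... | no _  = false

compMin : {n m : ℕ} → Mat n → Fin n → Mat m → Mat ((n ∸ 1) + m)
compMin B i C = blockMat B i C (λ _ c → at B (toℕ i) c)
                               (λ r j → if minBlock C j then at B r (toℕ i) else false)

compMax : {n m : ℕ} → Mat n → Fin n → Mat m → Mat ((n ∸ 1) + m)
compMax B i C = blockMat B i C (λ j c → if maxBlock C j then at B (toℕ i) c else false)
                               (λ r _ → at B r (toℕ i))

-- Reversing the order of the indices of B □ᵢ C sends the indices before i, the
-- inserted block C and the indices after i, each reversed, to the indices after,
-- inside and before the inserted block of B* □ₙ₋ᵢ₊₁ C*; transposing then turns the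
-- strip of copies of the row B_(i) into the strip of copies of the column B*^(n-i+1)
-- and vice versa, and C into C*. For ∘^min and ∘^max the one extra fact is that j is
-- minimal for C iff m+1-j is maximal for C*.
module Submission where

open import Defs
open import Data.Nat using (ℕ; zero; suc; _+_; _∸_; _<_; _≤_; _<ᵇ_; _<?_; s≤s)
open import Data.Nat.Properties
  using ( suc-injective; +-comm; +-assoc; +-suc; +-cancelˡ-≡; +-monoʳ-<; m≤m+n; ≤-trans; ≤-pred
        ; m+n∸m≡n; m+[n∸m]≡n; <⇒<ᵇ)
open import Data.Nat.Tactic.RingSolver using (solve-∀)
open import Data.Fin using (Fin; toℕ; fromℕ<; opposite; _≟_)
open import Data.Fin.Properties using (toℕ<n; toℕ-fromℕ<; fromℕ<-toℕ; opposite-prop; opposite-involutive)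
open import Data.Bool using (Bool; true; false; not; _∨_; if_then_else_)
open import Data.Bool.Properties using (⇔→≡; T-≡)
open import Data.Bool.ListAction using (and; all)
open import Data.List using (allFin)
open import Data.List.Properties using (map-cong)
open import Data.List.Relation.Unary.All.Properties using (all⁺; all⁻; tabulate⁺; tabulate⁻)
open import Data.Product using (_×_; _,_)
open import Function using (_∘_; mk⇔; Equivalence)
open import Relation.Nullary using (yes; no; ⌊_⌋; contradiction)
open import Relation.Binary.PropositionalEquality
open ≡-Reasoning

-- x' = n - 1 - x, stated without truncated subtraction.
record Mirror (n x x' : ℕ) : Set where
  constructor mirror
  field
    suc[x+x']≡n : suc (x + x') ≡ n

mirror-sym : ∀ {n x x'} → Mirror n x x' → Mirror n x' x
mirror-sym {x = x} {x'} (mirror refl) = mirror (cong suc (+-comm x' x))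

mirror-< : ∀ {n x x'} → Mirror n x x' → x < n
mirror-< {x = x} {x'} (mirror refl) = s≤s (m≤m+n x x')

mirror-unique : ∀ {n x y y'} → Mirror n x y → Mirror n x y' → y ≡ y'
mirror-unique {x = x} (mirror e) (mirror e') = +-cancelˡ-≡ x _ _ (suc-injective (trans e (sym e')))

mirror-shift : ∀ {n q r b b'} → Mirror q b b' → Mirror n r q → Mirror n (suc (r + b)) b'
mirror-shift {r = r} {b} {b'} (mirror refl) (mirror refl) =
  mirror (cong suc (trans (cong suc (+-assoc r b b')) (sym (+-suc r (b + b')))))

mirror-opposite : ∀ {n} (i : Fin n) → Mirror n (toℕ i) (toℕ (opposite i))
mirror-opposite {suc n} i =
  mirror (cong suc (trans (cong (toℕ i +_) (opposite-prop i)) (m+[n∸m]≡n (≤-pred (toℕ<n i)))))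

toℕ-opposite-fromℕ< : ∀ {n x x'} (e : Mirror n x x') → toℕ (opposite (fromℕ< (mirror-< e))) ≡ x'
toℕ-opposite-fromℕ< {n} e =
  mirror-unique (subst (λ y → Mirror n y (toℕ (opposite u))) (toℕ-fromℕ< (mirror-< e)) (mirror-opposite u)) e
  where
  u : Fin n
  u = fromℕ< (mirror-< e)

at-toℕ : ∀ {n} (A : Mat n) (u v : Fin n) → at A (toℕ u) (toℕ v) ≡ A u v
at-toℕ {n} A u v with toℕ u <? n | toℕ v <? n
... | yes _   | yes _   = cong₂ A (fromℕ<-toℕ u _) (fromℕ<-toℕ v _)
... | no u≮n  | _       = contradiction (toℕ<n u) u≮n
... | yes _   | no v≮n  = contradiction (toℕ<n v) v≮n

at-dual : ∀ {n r r' c c'} (A : Mat n) → Mirror n r r' → Mirror n c c' → at (dual A) r c ≡ at A c' r'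
at-dual {n} {r} {r'} {c} {c'} A er ec = begin
  at (dual A) r c
    ≡⟨ cong₂ (at (dual A)) (toℕ-fromℕ< (mirror-< er)) (toℕ-fromℕ< (mirror-< ec)) ⟨
  at (dual A) (toℕ u) (toℕ v)
    ≡⟨ at-toℕ (dual A) u v ⟩
  A (opposite v) (opposite u)
    ≡⟨ at-toℕ A (opposite v) (opposite u) ⟨
  at A (toℕ (opposite v)) (toℕ (opposite u))
    ≡⟨ cong₂ (at A) (toℕ-opposite-fromℕ< ec) (toℕ-opposite-fromℕ< er) ⟩
  at A c' r'
    ∎
  where
  u v : Fin n
  u = fromℕ< (mirror-< er)
  v = fromℕ< (mirror-< ec)

opposite-injective : ∀ {n} {s v : Fin n} → opposite s ≡ opposite v → s ≡ v
opposite-injective {s = s} {v} e = trans (sym (opposite-involutive s)) (trans (cong opposite e) (opposite-involutive v))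

⌊opposite≟opposite⌋ : ∀ {n} (s v : Fin n) → ⌊ opposite s ≟ opposite v ⌋ ≡ ⌊ s ≟ v ⌋
⌊opposite≟opposite⌋ s v with s ≟ v | opposite s ≟ opposite v
... | yes _    | yes _ = refl
... | no _     | no _  = refl
... | yes refl | no s≢s  = contradiction refl s≢s
... | no s≢v   | yes eq  = contradiction (opposite-injective eq) s≢v

all-allFin⁻ : ∀ {n} (f : Fin n → Bool) → all f (allFin n) ≡ true → ∀ x → f x ≡ true
all-allFin⁻ f h x = Equivalence.to T-≡ (tabulate⁻ (all⁺ f _ (Equivalence.from T-≡ h)) x)

all-allFin⁺ : ∀ {n} (f : Fin n → Bool) → (∀ x → f x ≡ true) → all f (allFin n) ≡ true
all-allFin⁺ f h = Equivalence.to T-≡ (all⁻ f (tabulate⁺ (Equivalence.from T-≡ ∘ h)))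

all-allFin-opposite : ∀ {n} (f : Fin n → Bool) → all (f ∘ opposite) (allFin n) ≡ all f (allFin n)
all-allFin-opposite f = ⇔→≡ (mk⇔
  (λ h → all-allFin⁺ f (λ x →
    subst (λ y → f y ≡ true) (opposite-involutive x) (all-allFin⁻ (f ∘ opposite) h (opposite x))))
  (λ h → all-allFin⁺ (f ∘ opposite) (all-allFin⁻ f h ∘ opposite)))

maximalᵇ-dual : ∀ {m} (C : Mat m) (v : Fin m) → maximalᵇ (dual C) v ≡ minimalᵇ C (opposite v)
maximalᵇ-dual {m} C v = begin
  maximalᵇ (dual C) v                 ≡⟨ cong and (map-cong same-test (allFin m)) ⟨
  all (minimal ∘ opposite) (allFin m) ≡⟨ all-allFin-opposite minimal ⟩
  minimalᵇ C (opposite v)             ∎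
  where
  minimal : Fin m → Bool
  minimal t = ⌊ t ≟ opposite v ⌋ ∨ not (C (opposite v) t)
  same-test : ∀ s → minimal (opposite s) ≡ ⌊ s ≟ v ⌋ ∨ not (C (opposite v) (opposite s))
  same-test s = cong (_∨ not (C (opposite v) (opposite s))) (⌊opposite≟opposite⌋ s v)

minBlock-toℕ : ∀ {m} (C : Mat m) (u : Fin m) → minBlock C (toℕ u) ≡ minimalᵇ C u
minBlock-toℕ {m} C u with toℕ u <? m
... | yes _   = cong (minimalᵇ C) (fromℕ<-toℕ u _)
... | no u≮m  = contradiction (toℕ<n u) u≮m

maxBlock-toℕ : ∀ {m} (C : Mat m) (u : Fin m) → maxBlock C (toℕ u) ≡ maximalᵇ C u
maxBlock-toℕ {m} C u with toℕ u <? m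
... | yes _   = cong (maximalᵇ C) (fromℕ<-toℕ u _)
... | no u≮m  = contradiction (toℕ<n u) u≮m

maxBlock-dual : ∀ {m j j'} (C : Mat m) → Mirror m j j' → maxBlock (dual C) j ≡ minBlock C j'
maxBlock-dual {m} {j} {j'} C e = begin
  maxBlock (dual C) j              ≡⟨ cong (maxBlock (dual C)) (toℕ-fromℕ< (mirror-< e)) ⟨
  maxBlock (dual C) (toℕ u)        ≡⟨ maxBlock-toℕ (dual C) u ⟩
  maximalᵇ (dual C) u              ≡⟨ maximalᵇ-dual C u ⟩
  minimalᵇ C (opposite u)          ≡⟨ minBlock-toℕ C (opposite u) ⟨
  minBlock C (toℕ (opposite u))    ≡⟨ cong (minBlock C) (toℕ-opposite-fromℕ< e) ⟩
  minBlock C j'                    ∎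
  where
  u : Fin m
  u = fromℕ< (mirror-< e)

-- Where an index x of a matrix of order k + m + p lies relative to a block occupying
-- [k, k + m); recording the mirror index x' makes reversal a mere relabelling.
data Position (k m p : ℕ) : ℕ → ℕ → Set where
  before : ∀ {a a'} → Mirror k a a' → Position k m p a (p + m + a')
  inside : ∀ {j j'} → Mirror m j j' → Position k m p (k + j) (p + j')
  after  : ∀ {b b'} → Mirror p b b' → Position k m p (k + m + b) b'

mirror-position : ∀ {k m p x x'} → Position k m p x x' → Position p m k x' x
mirror-position (before e) = after (mirror-sym e)
mirror-position (inside e) = inside (mirror-sym e)
mirror-position (after e)  = before (mirror-sym e)

position : ∀ k m p {x x'} → Mirror (k + m + p) x x' → Position k m p x x'
position zero    zero    p         e            = after e
position zero    (suc m) p {zero}  (mirror e)   =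
  subst (Position 0 (suc m) p 0) (trans (+-comm p m) (sym (suc-injective e))) (inside (mirror refl))
position zero    (suc m) p {suc x} (mirror e)   = next-inside (position zero m p (mirror (suc-injective e)))
  where
  next-inside : ∀ {x x'} → Position 0 m p x x' → Position 0 (suc m) p (suc x) x'
  next-inside (before (mirror ()))
  next-inside (inside (mirror e′)) = inside (mirror (cong suc e′))
  next-inside (after e′)           = after e′
position (suc k) m       p {zero}  (mirror e)   =
  subst (Position (suc k) m p 0) (trans (reorder p m k) (sym (suc-injective e))) (before (mirror refl))
  where
  reorder : ∀ p m k → p + m + k ≡ k + m + p
  reorder = solve-∀
position (suc k) m       p {suc x} (mirror e)   = next-before (position k m p (mirror (suc-injective e)))
  where
  next-before : ∀ {x x'} → Position k m p x x' → Position (suc k) m p (suc x) x'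
  next-before (before (mirror e′)) = before (mirror (cong suc e′))
  next-before (inside e′)          = inside e′
  next-before (after e′)           = after e′

<ᵇ-false : ∀ {x k} → k ≤ x → (x <ᵇ k) ≡ false
<ᵇ-false {x}     {zero}  _       = refl
<ᵇ-false {suc x} {suc k} (s≤s h) = <ᵇ-false h

regionOf : ∀ {k m p x x'} → Position k m p x x' → Region
regionOf (before _) = R1
regionOf (inside _) = R2
regionOf (after _)  = R3

region-position : ∀ {k m p x x'} (px : Position k m p x x') → region k m x ≡ regionOf px
region-position (before e) rewrite Equivalence.to T-≡ (<⇒<ᵇ (mirror-< e)) = refl
region-position {k} {m} (inside {j} e)
  rewrite <ᵇ-false (m≤m+n k j) | Equivalence.to T-≡ (<⇒<ᵇ (+-monoʳ-< k (mirror-< e))) = refl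
region-position {k} {m} (after {b} _)
  rewrite <ᵇ-false (≤-trans (m≤m+n k m) (m≤m+n (k + m) b)) | <ᵇ-false (m≤m+n (k + m) b) = refl

after-index : ∀ k m b → k + m + b + 1 ∸ m ≡ suc (k + b)
after-index k m b = trans (cong (_∸ m) (reorder k m b)) (m+n∸m≡n m (suc (k + b)))
  where
  reorder : ∀ k m b → k + m + b + 1 ≡ m + suc (k + b)
  reorder = solve-∀

module _ {n m : ℕ} (B : Mat n) (k : ℕ) (C : Mat m) (L D : ℕ → ℕ → Bool) where

  -- The local function go of blockMat, lifted so that it can be evaluated at ℕ indices.
  blockCell : Region → Region → ℕ → ℕ → Bool
  blockCell R1 R1 r c = at B r c
  blockCell R2 R1 r c = L (r ∸ k) c
  blockCell R2 R2 r c = at C (r ∸ k) (c ∸ k)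
  blockCell R3 R1 r c = at B (r + 1 ∸ m) c
  blockCell R3 R2 r c = D (r + 1 ∸ m) (c ∸ k)
  blockCell R3 R3 r c = at B (r + 1 ∸ m) (c + 1 ∸ m)
  blockCell _  _  _ _ = false

  blockEntry : ∀ {p r r' c c'} → Position k m p r r' → Position k m p c c' → Bool
  blockEntry (before {a} _) (before {a₂} _) = at B a a₂
  blockEntry (inside {j} _) (before {a₂} _) = L j a₂
  blockEntry (inside {j} _) (inside {j₂} _) = at C j j₂
  blockEntry (after {b} _)  (before {a₂} _) = at B (suc (k + b)) a₂
  blockEntry (after {b} _)  (inside {j₂} _) = D (suc (k + b)) j₂
  blockEntry (after {b} _)  (after {b₂} _)  = at B (suc (k + b)) (suc (k + b₂))
  blockEntry _              _               = false

  blockCell-position : ∀ {p r r' c c'} (pr : Position k m p r r') (pc : Position k m p c c')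
    → blockCell (regionOf pr) (regionOf pc) r c ≡ blockEntry pr pc
  blockCell-position (before _)     (before _)      = refl
  blockCell-position (before _)     (inside _)      = refl
  blockCell-position (before _)     (after _)       = refl
  blockCell-position (inside {j} _) (before {a₂} _) = cong (λ x → L x a₂) (m+n∸m≡n k j)
  blockCell-position (inside {j} _) (inside {j₂} _) = cong₂ (at C) (m+n∸m≡n k j) (m+n∸m≡n k j₂)
  blockCell-position (inside _)     (after _)       = refl
  blockCell-position (after {b} _)  (before {a₂} _) = cong (λ x → at B x a₂) (after-index k m b)
  blockCell-position (after {b} _)  (inside {j₂} _) = cong₂ D (after-index k m b) (m+n∸m≡n k j₂)
  blockCell-position (after {b} _)  (after {b₂} _)  = cong₂ (at B) (after-index k m b) (after-index k m b₂)

module _ {n m : ℕ} (B : Mat n) (i : Fin n) (C : Mat m) (L D : ℕ → ℕ → Bool) where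

  blockMat-blockCell : ∀ s t → blockMat B i C L D s t
    ≡ blockCell B (toℕ i) C L D (region (toℕ i) m (toℕ s)) (region (toℕ i) m (toℕ t)) (toℕ s) (toℕ t)
  blockMat-blockCell s t with region (toℕ i) m (toℕ s) | region (toℕ i) m (toℕ t)
  ... | R1 | R1 = refl
  ... | R1 | R2 = refl
  ... | R1 | R3 = refl
  ... | R2 | R1 = refl
  ... | R2 | R2 = refl
  ... | R2 | R3 = refl
  ... | R3 | R1 = refl
  ... | R3 | R2 = refl
  ... | R3 | R3 = refl

  blockMat-position : ∀ {p s' t'} s t
    (ps : Position (toℕ i) m p (toℕ s) s') (pt : Position (toℕ i) m p (toℕ t) t')
    → blockMat B i C L D s t ≡ blockEntry B (toℕ i) C L D ps pt
  blockMat-position s t ps pt = begin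
    blockMat B i C L D s t
      ≡⟨ blockMat-blockCell s t ⟩
    blockCell B (toℕ i) C L D (region (toℕ i) m (toℕ s)) (region (toℕ i) m (toℕ t)) (toℕ s) (toℕ t)
      ≡⟨ cong₂ (λ ρ γ → blockCell B (toℕ i) C L D ρ γ (toℕ s) (toℕ t))
               (region-position ps) (region-position pt) ⟩
    blockCell B (toℕ i) C L D (regionOf ps) (regionOf pt) (toℕ s) (toℕ t)
      ≡⟨ blockCell-position B (toℕ i) C L D ps pt ⟩
    blockEntry B (toℕ i) C L D ps pt
      ∎

module _ {n m k p : ℕ} (B : Mat n) (C : Mat m) (kp : Mirror n k p) where

  mirror-before : ∀ {a a'} → Mirror p a a' → Mirror n a (suc (k + a'))
  mirror-before e = mirror-sym (mirror-shift (mirror-sym e) kp)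

  mirror-after : ∀ {b b'} → Mirror k b b' → Mirror n (suc (p + b)) b'
  mirror-after e = mirror-shift e (mirror-sym kp)

  column-dual : ∀ {a a'} → Mirror p a a' → at B (suc (k + a')) k ≡ at (dual B) p a
  column-dual e = sym (at-dual B (mirror-sym kp) (mirror-before e))

  row-dual : ∀ {b b'} → Mirror k b b' → at B k b' ≡ at (dual B) (suc (p + b)) p
  row-dual e = sym (at-dual B (mirror-after e) (mirror-sym kp))

  module _ (L D L' D' : ℕ → ℕ → Bool)
    (L≡D' : ∀ {j j' b b'} → Mirror m j j' → Mirror k b b' → L j' b' ≡ D' (suc (p + b)) j)
    (D≡L' : ∀ {j j' a a'} → Mirror m j j' → Mirror p a a' → D (suc (k + a')) j' ≡ L' j a) where

    blockEntry-mirror : ∀ {r r' c c'} (pr : Position p m k r r') (pc : Position p m k c c')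
      → blockEntry B k C L D (mirror-position pc) (mirror-position pr)
        ≡ blockEntry (dual B) p (dual C) L' D' pr pc
    blockEntry-mirror (before e) (before e₂) = sym (at-dual B (mirror-before e) (mirror-before e₂))
    blockEntry-mirror (before _) (inside _)  = refl
    blockEntry-mirror (before _) (after _)   = refl
    blockEntry-mirror (inside e) (before e₂) = D≡L' e e₂
    blockEntry-mirror (inside e) (inside e₂) = sym (at-dual C e e₂)
    blockEntry-mirror (inside _) (after _)   = refl
    blockEntry-mirror (after e)  (before e₂) = sym (at-dual B (mirror-after e) (mirror-before e₂))
    blockEntry-mirror (after e)  (inside e₂) = L≡D' e₂ e
    blockEntry-mirror (after e)  (after e₂)  = sym (at-dual B (mirror-after e) (mirror-after e₂))

module _ {n₀ m : ℕ} (B : Mat (suc n₀)) (C : Mat m) (i : Fin (suc n₀)) where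

  private
    k p : ℕ
    k = toℕ i
    p = toℕ (opposite i)

  position-opposite : (s : Fin (n₀ + m)) → Position p m k (toℕ s) (toℕ (opposite s))
  position-opposite s =
    position p m k (subst (λ N → Mirror N (toℕ s) (toℕ (opposite s))) size (mirror-opposite s))
    where
    reorder : ∀ k p m → k + p + m ≡ p + m + k
    reorder = solve-∀
    size : n₀ + m ≡ p + m + k
    size = trans (cong (_+ m) (sym (suc-injective (Mirror.suc[x+x']≡n (mirror-opposite i))))) (reorder k p m)

  dual-blockMat : (L D L' D' : ℕ → ℕ → Bool)
    → (∀ {j j' b b'} → Mirror m j j' → Mirror k b b' → L j' b' ≡ D' (suc (p + b)) j)
    → (∀ {j j' a a'} → Mirror m j j' → Mirror p a a' → D (suc (k + a')) j' ≡ L' j a)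
    → ∀ (A : Mat (n₀ + m)) → A ≡ᴹ blockMat B i C L D
    → dual A ≡ᴹ blockMat (dual B) (opposite i) (dual C) L' D'
  dual-blockMat L D L' D' L≡D' D≡L' A A≡ s t = begin
    A (opposite t) (opposite s)
      ≡⟨ A≡ (opposite t) (opposite s) ⟩
    blockMat B i C L D (opposite t) (opposite s)
      ≡⟨ blockMat-position B i C L D _ _ (mirror-position pt) (mirror-position ps) ⟩
    blockEntry B k C L D (mirror-position pt) (mirror-position ps)
      ≡⟨ blockEntry-mirror B C (mirror-opposite i) L D L' D' L≡D' D≡L' ps pt ⟩
    blockEntry (dual B) p (dual C) L' D' ps pt
      ≡⟨ blockMat-position (dual B) (opposite i) (dual C) L' D' s t ps pt ⟨
    blockMat (dual B) (opposite i) (dual C) L' D' s t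
      ∎
    where
    ps : Position p m k (toℕ s) (toℕ (opposite s))
    ps = position-opposite s
    pt : Position p m k (toℕ t) (toℕ (opposite t))
    pt = position-opposite t

theorem10 : (n m : ℕ) (B : Mat n) (C : Mat m) → IsPosetMatrix B → IsPosetMatrix C → (i : Fin n)
    → (∀ (A : Mat _) → A ≡ᴹ box B i C → dual A ≡ᴹ box (dual B) (opposite i) (dual C))
      × (∀ (A : Mat _) → A ≡ᴹ compMin B i C → dual A ≡ᴹ compMax (dual B) (opposite i) (dual C))
theorem10 (suc n₀) m B C _ _ i =
    dual-blockMat B C i _ _ _ _ (λ _ → row-dual B C kp) (λ _ → column-dual B C kp)
  , dual-blockMat B C i _ _ _ _ (λ _ → row-dual B C kp)
      (λ e e₂ → cong₂ (λ b x → if b then x else false) (sym (maxBlock-dual C e)) (column-dual B C kp e₂))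
  where
  kp : Mirror (suc n₀) (toℕ i) (toℕ (opposite i))
  kp = mirror-opposite i
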